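{- For every integer $r\ge 2$ and $n\ge 1$, every full hypergraph of rank at most $r$ having at least $\tfrac{27}{8}\,r(n+1)^2$ vertices contains a full subhypergraph of rank at most two having at least $n$ vertices.
   Context: Hypergraphs are finite. A hypergraph is full if every pair of distinct vertices is contained in some hyperedge. The rank of a hypergraph is the maximum size of a hyperedge. Given a hypergraph $\mathcal{H}$ and $X\subseteq V(\mathcal{H})$, a subhypergraph of $\mathcal{H}$ on $X$ is a hypergraph with vertex set $X$ whose hyperedge set is a subset of $\{X\cap e : e\in E(\mathcal{H})\}$. -}

module Defs where

open import Data.Nat using (ℕ; _≤_)
open import Data.Fin using (Fin)
open import Data.Fin.Subset using (Subset; _∈_; _∩_; ∣_∣; _⊆_)
open import Data.List using (List)
import Data.List.Membership.Propositional as L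
open import Data.List.Relation.Unary.All using (All)
open import Data.List.Relation.Unary.Any using (Any)
open import Data.Product using (Σ; _×_; ∃-syntax)
open import Relation.Binary.PropositionalEquality using (_≡_; _≢_)

record Hypergraph (N : ℕ) : Set where
  constructor hypergraph
  field
    edges : List (Subset N)
open Hypergraph public

FullOn : ∀ {N} → Subset N → List (Subset N) → Set
FullOn X E = ∀ u v → u ∈ X → v ∈ X → u ≢ v → Any (λ e → u ∈ e × v ∈ e) E

RankAtMost : ∀ {N} → ℕ → List (Subset N) → Set
RankAtMost r E = All (λ e → ∣ e ∣ ≤ r) E

Full : ∀ {N} → Hypergraph N → Set
Full {N} H = ∀ (u v : Fin N) → u ≢ v → Any (λ e → u ∈ e × v ∈ e) (edges H)

-- F is the edge set of a subhypergraph of H on X: every member of F is X ∩ e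
-- for some hyperedge e of H.
SubEdges : ∀ {N} → Hypergraph N → Subset N → List (Subset N) → Set
SubEdges H X F = All (λ f → ∃[ e ] (e L.∈ edges H × f ≡ X ∩ e)) F

HasFullRank2Sub : ∀ {N} → Hypergraph N → ℕ → Set
HasFullRank2Sub {N} H n =
  ∃[ X ] ∃[ F ] (n ≤ ∣ X ∣ × SubEdges H X F × FullOn X F × RankAtMost 2 F)

module Submission where

-- Fix, for every pair u < v, one hyperedge e(u,v) of H containing both, and call
-- (u, v, w) a bad triple when w is a third vertex of e(u,v).  If a vertex set X
-- contains no bad triple, every e(u,v) with u, v ∈ X meets X in {u, v} only, so
-- the traces X ∩ e of size ≤ 2 form a full subhypergraph of rank ≤ 2 on X.
-- There are at most r·N²/2 bad triples.  Deleting a suitable vertex from a set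
-- of M vertices keeps at most a fraction (M−3)/M ≤ ((M−1)/M)³ of the bad triples
-- inside it (an averaging argument), so greedily shrinking V(H) to M = ⌊3(n+1)/2⌋
-- vertices leaves t ≤ r·M³/(2N) bad triples; further deletions, each destroying
-- at least one bad triple, cost at most t vertices, and the hypothesis on N
-- makes M − t ≥ n.

open import Defs
open import Data.Nat using (ℕ; zero; suc; _+_; _*_; _∸_; _^_; _≤_; _<_; _≤?_; _≟_; z≤n; s≤s; >-nonZero; ≢-nonZero)
open import Data.Nat.Properties
open import Data.Nat.Tactic.RingSolver using (solve-∀)
open import Data.Bool using (if_then_else_)
open import Data.Fin using (Fin; zero; suc)
import Data.Fin.Properties as Fin
open import Data.Fin.Subset using (Subset; inside; outside; _∈_; _∉_; _∩_; _-_; ∣_∣; ⊤; ⊥; ⁅_⁆)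
open import Data.Fin.Subset.Properties
  using (_∈?_; p─⊥≡p; x∈p∧x≢y⇒x∈p-y; ∈⊤; ∣⊤∣≡n; ∣⊥∣≡0; x∈⁅x⁆; ∣⁅x⁆∣≡1; x∈p∩q⁺)
open import Data.Vec using ([]; _∷_; here; there)
open import Data.List using (List; map; filter)
import Data.List.Membership.Propositional as L
open import Data.List.Membership.Propositional using (find; lose)
open import Data.List.Membership.Propositional.Properties using (∈-map⁺; ∈-map⁻; ∈-filter⁺; ∈-filter⁻)
import Data.List.Relation.Unary.All as All
open import Data.List.Relation.Unary.All.Properties using (all-filter)
import Data.List.Relation.Unary.Any as Any
open import Data.Product using (_×_; _,_; proj₁; proj₂; ∃-syntax; swap)
open import Data.Sum using (_⊎_; inj₁; inj₂)
open import Data.Empty using (⊥-elim)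
open import Function using (_∘_)
open import Relation.Nullary using (yes; no)
open import Relation.Nullary.Decidable using (_×-dec_)
open import Relation.Binary.PropositionalEquality
open import Algebra.Properties.CommutativeSemigroup *-commutativeSemigroup using (x∙yz≈y∙xz; xy∙z≈y∙xz)
open import Algebra.Properties.Semiring.Sum +-*-semiring
  using (sum; sum-cong-≗; sum-replicate-zero; ∑-comm; ∑-distrib-+; *-distribˡ-sum; *-distribʳ-sum)

sum-mono : ∀ {n} {f g : Fin n → ℕ} → (∀ x → f x ≤ g x) → sum f ≤ sum g
sum-mono {zero} _ = z≤n
sum-mono {suc n} f≤g = +-mono-≤ (f≤g zero) (sum-mono (f≤g ∘ suc))

sum-const : ∀ n c → sum {n} (λ _ → c) ≡ n * c
sum-const zero c = refl
sum-const (suc n) c = cong (c +_) (sum-const n c)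

sum-vanishes : ∀ {n} {f : Fin n → ℕ} → (∀ x → f x ≡ 0) → sum f ≡ 0
sum-vanishes {n} f≡0 = trans (sum-cong-≗ f≡0) (sum-replicate-zero n)

sum≡0 : ∀ {n} (f : Fin n → ℕ) → sum f ≡ 0 → ∀ x → f x ≡ 0
sum≡0 f total zero = m+n≡0⇒m≡0 (f zero) total
sum≡0 f total (suc x) = sum≡0 (f ∘ suc) (m+n≡0⇒n≡0 (f zero) total) x

sum-scale : ∀ {n} c (f : Fin n → ℕ) → sum (λ x → c * f x) ≡ c * sum f
sum-scale c f = sym (*-distribˡ-sum c f)

∑-interchange : ∀ {m n} (c : Fin m → ℕ) (f : Fin m → Fin n → ℕ) →
  sum (λ x → c x * sum (f x)) ≡ sum (λ y → sum (λ x → c x * f x y))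
∑-interchange c f = trans (sum-cong-≗ (λ x → *-distribˡ-sum (c x) (f x))) (∑-comm (λ x y → c x * f x y))

𝟙 : ∀ {n} → Subset n → Fin n → ℕ
𝟙 (b ∷ _) zero = if b then 1 else 0
𝟙 (_ ∷ s) (suc x) = 𝟙 s x

𝟙∈ : ∀ {n} {s : Subset n} {x} → x ∈ s → 𝟙 s x ≡ 1
𝟙∈ here = refl
𝟙∈ (there x∈s) = 𝟙∈ x∈s

𝟙∉ : ∀ {n} {s : Subset n} {x} → x ∉ s → 𝟙 s x ≡ 0
𝟙∉ {s = inside ∷ _} {zero} x∉s = ⊥-elim (x∉s here)
𝟙∉ {s = outside ∷ _} {zero} x∉s = refl
𝟙∉ {s = _ ∷ _} {suc x} x∉s = 𝟙∉ (x∉s ∘ there)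

𝟙≢0⇒∈ : ∀ {n} (s : Subset n) x → 𝟙 s x ≢ 0 → x ∈ s
𝟙≢0⇒∈ s x nonzero with x ∈? s
... | yes x∈s = x∈s
... | no x∉s = ⊥-elim (nonzero (𝟙∉ x∉s))

𝟙≤1 : ∀ {n} (s : Subset n) x → 𝟙 s x ≤ 1
𝟙≤1 s x with x ∈? s
... | yes x∈s = ≤-reflexive (𝟙∈ x∈s)
... | no x∉s = ≤-trans (≤-reflexive (𝟙∉ x∉s)) z≤n

sum-𝟙 : ∀ {n} (s : Subset n) → sum (𝟙 s) ≡ ∣ s ∣
sum-𝟙 [] = refl
sum-𝟙 (inside ∷ s) = cong suc (sum-𝟙 s)
sum-𝟙 (outside ∷ s) = sum-𝟙 s

𝟙-∩ : ∀ {n} (s e : Subset n) x → 𝟙 (s ∩ e) x ≡ 𝟙 s x * 𝟙 e x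
𝟙-∩ (inside ∷ _) (inside ∷ _) zero = refl
𝟙-∩ (inside ∷ _) (outside ∷ _) zero = refl
𝟙-∩ (outside ∷ _) (_ ∷ _) zero = refl
𝟙-∩ (_ ∷ s) (_ ∷ e) (suc x) = 𝟙-∩ s e x

𝟙≢ : ∀ {n} → Fin n → Fin n → ℕ
𝟙≢ zero zero = 0
𝟙≢ zero (suc _) = 1
𝟙≢ (suc _) zero = 1
𝟙≢ (suc x) (suc y) = 𝟙≢ x y

𝟙≢-refl : ∀ {n} (x : Fin n) → 𝟙≢ x x ≡ 0
𝟙≢-refl zero = refl
𝟙≢-refl (suc x) = 𝟙≢-refl x

𝟙≢-sym : ∀ {n} (x y : Fin n) → 𝟙≢ x y ≡ 𝟙≢ y x
𝟙≢-sym zero zero = refl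
𝟙≢-sym zero (suc _) = refl
𝟙≢-sym (suc _) zero = refl
𝟙≢-sym (suc x) (suc y) = 𝟙≢-sym x y

𝟙≢≤1 : ∀ {n} (x y : Fin n) → 𝟙≢ x y ≤ 1
𝟙≢≤1 zero zero = z≤n
𝟙≢≤1 zero (suc _) = ≤-refl
𝟙≢≤1 (suc _) zero = ≤-refl
𝟙≢≤1 (suc x) (suc y) = 𝟙≢≤1 x y

𝟙≢≢0⇒≢ : ∀ {n} (x y : Fin n) → 𝟙≢ x y ≢ 0 → x ≢ y
𝟙≢≢0⇒≢ x .x nonzero refl = nonzero (𝟙≢-refl x)

𝟙≢-≢ : ∀ {n} {x y : Fin n} → x ≢ y → 𝟙≢ x y ≡ 1
𝟙≢-≢ {x = zero} {zero} x≢y = ⊥-elim (x≢y refl)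
𝟙≢-≢ {x = zero} {suc _} _ = refl
𝟙≢-≢ {x = suc _} {zero} _ = refl
𝟙≢-≢ {x = suc x} {suc y} x≢y = 𝟙≢-≢ (x≢y ∘ cong suc)

𝟙-del : ∀ {n} (s : Subset n) y x → 𝟙 (s - y) x ≡ 𝟙 s x * 𝟙≢ y x
𝟙-del (b ∷ s) zero zero = sym (*-zeroʳ (𝟙 (b ∷ s) zero))
𝟙-del (_ ∷ s) zero (suc x) = trans (cong (λ t → 𝟙 t x) (p─⊥≡p s)) (sym (*-identityʳ (𝟙 s x)))
𝟙-del (b ∷ s) (suc y) zero = sym (*-identityʳ (𝟙 (b ∷ s) zero))
𝟙-del (_ ∷ s) (suc y) (suc x) = 𝟙-del s y x

card-del : ∀ {n} {s : Subset n} {x} → x ∈ s → suc ∣ s - x ∣ ≡ ∣ s ∣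
card-del {s = inside ∷ s} here = cong (suc ∘ ∣_∣) (p─⊥≡p s)
card-del {s = inside ∷ _} (there x∈s) = cong suc (card-del x∈s)
card-del {s = outside ∷ _} (there x∈s) = card-del x∈s

𝟙< : ∀ {n} → Fin n → Fin n → ℕ
𝟙< zero zero = 0
𝟙< zero (suc _) = 1
𝟙< (suc _) zero = 0
𝟙< (suc x) (suc y) = 𝟙< x y

𝟙<-irrefl : ∀ {n} (x : Fin n) → 𝟙< x x ≡ 0
𝟙<-irrefl zero = refl
𝟙<-irrefl (suc x) = 𝟙<-irrefl x

𝟙<≢0⇒≢ : ∀ {n} (x y : Fin n) → 𝟙< x y ≢ 0 → x ≢ y
𝟙<≢0⇒≢ x .x nonzero refl = nonzero (𝟙<-irrefl x)

𝟙<-asym : ∀ {n} (x y : Fin n) → 𝟙< x y + 𝟙< y x ≤ 1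
𝟙<-asym zero zero = z≤n
𝟙<-asym zero (suc _) = ≤-refl
𝟙<-asym (suc _) zero = ≤-refl
𝟙<-asym (suc x) (suc y) = 𝟙<-asym x y

𝟙<-total : ∀ {n} {x y : Fin n} → x ≢ y → 𝟙< x y ≡ 1 ⊎ 𝟙< y x ≡ 1
𝟙<-total {x = zero} {zero} x≢y = ⊥-elim (x≢y refl)
𝟙<-total {x = zero} {suc _} _ = inj₁ refl
𝟙<-total {x = suc _} {zero} _ = inj₂ refl
𝟙<-total {x = suc x} {suc y} x≢y = 𝟙<-total (x≢y ∘ cong suc)

ordered-pairs : ∀ n → 2 * sum (λ x → sum (λ y → 𝟙< {n} x y)) ≤ n * n
ordered-pairs n = begin
  2 * P                                                ≡⟨ cong (P +_) (+-identityʳ P) ⟩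
  P + P                                                ≡⟨ cong (P +_) (∑-comm lt) ⟩
  P + sum (λ x → sum (λ y → lt y x))                   ≡⟨ ∑-distrib-+ (λ x → sum (lt x)) (λ x → sum (λ y → lt y x)) ⟨
  sum (λ x → sum (lt x) + sum (λ y → lt y x))          ≡⟨ sum-cong-≗ (λ x → ∑-distrib-+ (lt x) (λ y → lt y x)) ⟨
  sum (λ x → sum (λ y → lt x y + lt y x))              ≤⟨ sum-mono {n} (λ x → sum-mono (𝟙<-asym x)) ⟩
  sum {n} (λ _ → sum {n} (λ _ → 1))                    ≡⟨ sum-cong-≗ {n} (λ _ → trans (sum-const n 1) (*-identityʳ n)) ⟩
  sum {n} (λ _ → n)                                    ≡⟨ sum-const n n ⟩
  n * n                                                ∎
  where
  open ≤-Reasoning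
  lt : Fin n → Fin n → ℕ
  lt = 𝟙<
  P : ℕ
  P = sum (λ x → sum (λ y → lt x y))

*≢0 : ∀ a b → a * b ≢ 0 → a ≢ 0 × b ≢ 0
*≢0 a b ab≢0 = (λ a≡0 → ab≢0 (cong (_* b) a≡0)) , (λ b≡0 → ab≢0 (trans (cong (a *_) b≡0) (*-zeroʳ a)))

*-monoʳ-≤-nonzero : ∀ a {b c} → (a ≢ 0 → b ≤ c) → a * b ≤ a * c
*-monoʳ-≤-nonzero zero _ = z≤n
*-monoʳ-≤-nonzero a@(suc _) b≤c = *-monoʳ-≤ a (b≤c (λ ()))

-- M²(M − 3) ≤ (M − 1)³ for M = m + 1: the factor (M − 3)/M by which a good
-- deletion shrinks a count of triples is at most ((M − 1)/M)³.
cube-shrink : ∀ m → suc m * suc m * (suc m ∸ 3) ≤ m ^ 3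
cube-shrink 0 = z≤n
cube-shrink 1 = z≤n
cube-shrink (suc (suc j)) = ≤-trans (m≤m+n _ (3 * j + 8)) (≤-reflexive (expand j))
  where
  expand : ∀ j → (3 + j) * (3 + j) * j + (3 * j + 8) ≡ (2 + j) * ((2 + j) * ((2 + j) * 1))
  expand = solve-∀

density-step : ∀ a b m {M} T T′ → suc m ≡ M → M * T′ ≤ (M ∸ 3) * T →
  a * T ≤ b * M ^ 3 → a * T′ ≤ b * m ^ 3
density-step a b m T T′ refl fewer dense = *-cancelˡ-≤ (suc m) (begin
  suc m * (a * T′)          ≡⟨ x∙yz≈y∙xz (suc m) a T′ ⟩
  a * (suc m * T′)          ≤⟨ *-monoʳ-≤ a fewer ⟩
  a * (d * T)               ≡⟨ x∙yz≈y∙xz a d T ⟩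
  d * (a * T)               ≤⟨ *-monoʳ-≤ d dense ⟩
  d * (b * suc m ^ 3)       ≡⟨ regroup d b (suc m) ⟩
  suc m * (b * (suc m * suc m * d)) ≤⟨ *-monoʳ-≤ (suc m) (*-monoʳ-≤ b (cube-shrink m)) ⟩
  suc m * (b * m ^ 3)       ∎)
  where
  open ≤-Reasoning
  d : ℕ
  d = suc m ∸ 3
  regroup : ∀ d b M → d * (b * (M * (M * (M * 1)))) ≡ M * (b * (M * M * d))
  regroup = solve-∀

strict-decrease : ∀ M T T′ → 1 ≤ M → T ≢ 0 → M * T′ ≤ (M ∸ 3) * T → T′ < T
strict-decrease M@(suc m) T T′ _ T≢0 fewer = *-cancelˡ-< M T′ T (begin-strict
  M * T′        ≤⟨ fewer ⟩
  (M ∸ 3) * T   <⟨ *-monoˡ-< T {{≢-nonZero T≢0}} (s≤s (m∸n≤m m 2)) ⟩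
  M * T         ∎)
  where open ≤-Reasoning

averaging : ∀ {n} (s : Subset n) (f : Fin n → ℕ) K → 1 ≤ ∣ s ∣ →
  sum (λ x → 𝟙 s x * f x) ≤ K → ∃[ x ] (x ∈ s × ∣ s ∣ * f x ≤ K)
averaging s f K nonempty total with Fin.any? (λ x → x ∈? s ×-dec ∣ s ∣ * f x ≤? K)
... | yes found = found
... | no none = ⊥-elim (<⇒≱ (n<1+n K) (*-cancelˡ-≤ ∣ s ∣ {{>-nonZero nonempty}} overshoot))
  where
  open ≤-Reasoning
  exceeds : ∀ x → 𝟙 s x * suc K ≤ 𝟙 s x * (∣ s ∣ * f x)
  exceeds x with x ∈? s
  ... | yes x∈s rewrite 𝟙∈ x∈s = *-monoʳ-≤ 1 (≰⇒> (λ small → none (x , x∈s , small)))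
  ... | no x∉s rewrite 𝟙∉ x∉s = z≤n
  overshoot : ∣ s ∣ * suc K ≤ ∣ s ∣ * K
  overshoot = begin
    ∣ s ∣ * suc K                       ≡⟨ cong (_* suc K) (sym (sum-𝟙 s)) ⟩
    sum (𝟙 s) * suc K                   ≡⟨ *-distribʳ-sum (suc K) (𝟙 s) ⟩
    sum (λ x → 𝟙 s x * suc K)           ≤⟨ sum-mono exceeds ⟩
    sum (λ x → 𝟙 s x * (∣ s ∣ * f x))   ≡⟨ sum-cong-≗ (λ x → x∙yz≈y∙xz (𝟙 s x) ∣ s ∣ (f x)) ⟩
    sum (λ x → ∣ s ∣ * (𝟙 s x * f x))   ≡⟨ sym (*-distribˡ-sum ∣ s ∣ (λ x → 𝟙 s x * f x)) ⟩
    ∣ s ∣ * sum (λ x → 𝟙 s x * f x)     ≤⟨ *-monoʳ-≤ ∣ s ∣ total ⟩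
    ∣ s ∣ * K                           ∎

module TripleCount {n : ℕ} (g : Fin n → Fin n → Fin n → ℕ)
  (g-distinct : ∀ u v w → g u v w ≢ 0 → u ≢ v × u ≢ w × v ≢ w) where

  term : Subset n → Fin n → Fin n → Fin n → ℕ
  term s u v w = 𝟙 s u * 𝟙 s v * 𝟙 s w * g u v w

  T : Subset n → ℕ
  T s = sum λ u → sum λ v → sum λ w → term s u v w

  term-del : ∀ (s : Subset n) x u v w → term (s - x) u v w ≡ term s u v w * (𝟙≢ x u * 𝟙≢ x v * 𝟙≢ x w)
  term-del s x u v w rewrite 𝟙-del s x u | 𝟙-del s x v | 𝟙-del s x w =
    regroup (𝟙 s u) (𝟙≢ x u) (𝟙 s v) (𝟙≢ x v) (𝟙 s w) (𝟙≢ x w) (g u v w)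
    where
    regroup : ∀ a a′ b b′ c c′ e → a * a′ * (b * b′) * (c * c′) * e ≡ a * b * c * e * (a′ * b′ * c′)
    regroup = solve-∀

  survivors : ∀ (s : Subset n) u v w → u ∈ s → v ∈ s → w ∈ s → u ≢ v → u ≢ w → v ≢ w →
    sum (λ x → 𝟙 s x * (𝟙≢ x u * 𝟙≢ x v * 𝟙≢ x w)) ≡ ∣ s ∣ ∸ 3
  survivors s u v w u∈s v∈s w∈s u≢v u≢w v≢w = begin
    sum (λ x → 𝟙 s x * (𝟙≢ x u * 𝟙≢ x v * 𝟙≢ x w)) ≡⟨ sum-cong-≗ (λ x → sym (𝟙-del³ x)) ⟩
    sum (𝟙 (s - u - v - w))                          ≡⟨ sum-𝟙 (s - u - v - w) ⟩
    ∣ s - u - v - w ∣                                ≡⟨ cong (_∸ 3) sizes ⟩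
    ∣ s ∣ ∸ 3                                        ∎
    where
    open ≡-Reasoning
    v∈s-u : v ∈ s - u
    v∈s-u = x∈p∧x≢y⇒x∈p-y v∈s (u≢v ∘ sym)
    w∈s-u-v : w ∈ s - u - v
    w∈s-u-v = x∈p∧x≢y⇒x∈p-y (x∈p∧x≢y⇒x∈p-y w∈s (u≢w ∘ sym)) (v≢w ∘ sym)
    sizes : suc (suc (suc ∣ s - u - v - w ∣)) ≡ ∣ s ∣
    sizes = trans (cong (λ k → suc (suc k)) (card-del w∈s-u-v)) (trans (cong suc (card-del v∈s-u)) (card-del u∈s))
    assoc : ∀ a b c d → a * b * c * d ≡ a * (b * c * d)
    assoc = solve-∀
    𝟙-del³ : ∀ x → 𝟙 (s - u - v - w) x ≡ 𝟙 s x * (𝟙≢ x u * 𝟙≢ x v * 𝟙≢ x w)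
    𝟙-del³ x rewrite 𝟙-del (s - u - v) w x | 𝟙-del (s - u) v x | 𝟙-del s u x
                   | 𝟙≢-sym u x | 𝟙≢-sym v x | 𝟙≢-sym w x = assoc (𝟙 s x) (𝟙≢ x u) (𝟙≢ x v) (𝟙≢ x w)

  survival : ∀ (s : Subset n) u v w → sum (λ x → 𝟙 s x * term (s - x) u v w) ≤ (∣ s ∣ ∸ 3) * term s u v w
  survival s u v w = begin
    sum (λ x → 𝟙 s x * term (s - x) u v w) ≡⟨ sum-cong-≗ (λ x → trans (cong (𝟙 s x *_) (term-del s x u v w)) (x∙yz≈y∙xz (𝟙 s x) t _)) ⟩
    sum (λ x → t * (𝟙 s x * δ x))           ≡⟨ sum-scale t (λ x → 𝟙 s x * δ x) ⟩
    t * sum (λ x → 𝟙 s x * δ x)             ≤⟨ *-monoʳ-≤-nonzero t (≤-reflexive ∘ counted) ⟩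
    t * (∣ s ∣ ∸ 3)                         ≡⟨ *-comm t (∣ s ∣ ∸ 3) ⟩
    (∣ s ∣ ∸ 3) * t                         ∎
    where
    open ≤-Reasoning
    t : ℕ
    t = term s u v w
    δ : Fin n → ℕ
    δ x = 𝟙≢ x u * 𝟙≢ x v * 𝟙≢ x w
    counted : t ≢ 0 → sum (λ x → 𝟙 s x * δ x) ≡ ∣ s ∣ ∸ 3
    counted t≢0 =
      let (uvw≢0 , g≢0) = *≢0 (𝟙 s u * 𝟙 s v * 𝟙 s w) (g u v w) t≢0
          (uv≢0 , w≢0) = *≢0 (𝟙 s u * 𝟙 s v) (𝟙 s w) uvw≢0
          (u≢0 , v≢0) = *≢0 (𝟙 s u) (𝟙 s v) uv≢0
          (u≢v , u≢w , v≢w) = g-distinct u v w g≢0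
      in survivors s u v w (𝟙≢0⇒∈ s u u≢0) (𝟙≢0⇒∈ s v v≢0) (𝟙≢0⇒∈ s w w≢0) u≢v u≢w v≢w

  deletion-average : ∀ (s : Subset n) → sum (λ x → 𝟙 s x * T (s - x)) ≤ (∣ s ∣ ∸ 3) * T s
  deletion-average s = begin
    sum (λ x → 𝟙 s x * T (s - x))
      ≡⟨ ∑-interchange (𝟙 s) (λ x u → sum λ v → sum λ w → term (s - x) u v w) ⟩
    sum (λ u → sum λ x → 𝟙 s x * (sum λ v → sum λ w → term (s - x) u v w))
      ≡⟨ sum-cong-≗ (λ u → ∑-interchange (𝟙 s) (λ x v → sum λ w → term (s - x) u v w)) ⟩
    sum (λ u → sum λ v → sum λ x → 𝟙 s x * (sum λ w → term (s - x) u v w))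
      ≡⟨ sum-cong-≗ (λ u → sum-cong-≗ (λ v → ∑-interchange (𝟙 s) (λ x w → term (s - x) u v w))) ⟩
    sum (λ u → sum λ v → sum λ w → sum λ x → 𝟙 s x * term (s - x) u v w)
      ≤⟨ sum-mono (λ u → sum-mono (λ v → sum-mono (λ w → survival s u v w))) ⟩
    sum (λ u → sum λ v → sum λ w → K * term s u v w)
      ≡⟨ sum-cong-≗ (λ u → trans (sum-cong-≗ (λ v → sum-scale K (term s u v))) (sum-scale K (λ v → sum (term s u v)))) ⟩
    sum (λ u → K * (sum λ v → sum λ w → term s u v w))
      ≡⟨ sum-scale K (λ u → sum λ v → sum (term s u v)) ⟩
    K * T s ∎
    where
    open ≤-Reasoning
    K : ℕ
    K = ∣ s ∣ ∸ 3

  good-deletion : ∀ (s : Subset n) → 1 ≤ ∣ s ∣ → ∃[ x ] (x ∈ s × ∣ s ∣ * T (s - x) ≤ (∣ s ∣ ∸ 3) * T s)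
  good-deletion s nonempty = averaging s (λ x → T (s - x)) _ nonempty (deletion-average s)

  T-empty : ∀ (s : Subset n) → ∣ s ∣ ≡ 0 → T s ≡ 0
  T-empty s empty = sum-vanishes λ u → sum-vanishes λ v → sum-vanishes λ w →
    cong (λ k → k * 𝟙 s v * 𝟙 s w * g u v w) (sum≡0 (𝟙 s) (trans (sum-𝟙 s) empty) u)

  T≡0⇒term≡0 : ∀ (s : Subset n) → T s ≡ 0 → ∀ u v w → term s u v w ≡ 0
  T≡0⇒term≡0 s T≡0 u v w =
    sum≡0 (term s u v) (sum≡0 (λ v → sum (term s u v)) (sum≡0 (λ u → sum λ v → sum (term s u v)) T≡0 u) v) w

  weighted⇒nonempty : ∀ (s : Subset n) → T s ≢ 0 → 1 ≤ ∣ s ∣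
  weighted⇒nonempty s T≢0 = n≢0⇒n>0 (T≢0 ∘ T-empty s)

  shrink : ∀ a b M k (s : Subset n) → ∣ s ∣ ≡ k + M → a * T s ≤ b * ∣ s ∣ ^ 3 →
    ∃[ s′ ] (∣ s′ ∣ ≡ M × a * T s′ ≤ b * M ^ 3)
  shrink a b M zero s refl dense = s , refl , dense
  shrink a b M (suc k) s size dense with good-deletion s (subst (1 ≤_) (sym size) (s≤s z≤n))
  ... | x , x∈s , fewer = shrink a b M k (s - x) (suc-injective (trans (card-del x∈s) size))
          (density-step a b ∣ s - x ∣ (T s) (T (s - x)) (card-del x∈s) fewer dense)

  -- Phase 2: delete vertices until no weight is left; since each deletion
  -- strictly lowers the weight, at most T s vertices are lost.
  clean : ∀ B (s : Subset n) → T s ≤ B → ∃[ s′ ] (T s′ ≡ 0 × ∣ s ∣ ≤ ∣ s′ ∣ + B)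
  clean B s bound with T s ≟ 0
  ... | yes done = s , done , m≤m+n ∣ s ∣ B
  clean zero s bound | no T≢0 = ⊥-elim (T≢0 (n≤0⇒n≡0 bound))
  clean (suc B) s bound | no T≢0 with good-deletion s (weighted⇒nonempty s T≢0)
  ... | x , x∈s , fewer with clean B (s - x) (≤-pred (≤-trans lighter bound))
    where
    lighter : T (s - x) < T s
    lighter = strict-decrease ∣ s ∣ (T s) (T (s - x)) (weighted⇒nonempty s T≢0) T≢0 fewer
  ... | s′ , done , kept = s′ , done , (begin
    ∣ s ∣               ≡⟨ card-del x∈s ⟨
    suc ∣ s - x ∣       ≤⟨ s≤s kept ⟩
    suc (∣ s′ ∣ + B)    ≡⟨ +-suc ∣ s′ ∣ B ⟨
    ∣ s′ ∣ + suc B      ∎)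
    where open ≤-Reasoning

module ChosenEdges {N : ℕ} (H : Hypergraph N) (full : Full H) where

  -- the chosen edge through u and v (empty when u ≡ v)
  edge : Fin N → Fin N → Subset N
  edge u v with u Fin.≟ v
  ... | yes _ = ⊥
  ... | no u≢v = proj₁ (find (full u v u≢v))

  edge-spec : ∀ u v → u ≢ v → edge u v L.∈ edges H × u ∈ edge u v × v ∈ edge u v
  edge-spec u v u≢v with u Fin.≟ v
  ... | yes u≡v = ⊥-elim (u≢v u≡v)
  ... | no u≢v = proj₂ (find (full u v u≢v))

  edge-size : ∀ {r} → RankAtMost r (edges H) → ∀ u v → ∣ edge u v ∣ ≤ r
  edge-size rank u v with u Fin.≟ v
  ... | yes _ = ≤-trans (≤-reflexive (∣⊥∣≡0 N)) z≤n
  ... | no u≢v = All.lookup rank (proj₁ (proj₂ (find (full u v u≢v))))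

  bad : Fin N → Fin N → Fin N → ℕ
  bad u v w = 𝟙< u v * 𝟙≢ u w * 𝟙≢ v w * 𝟙 (edge u v) w

  bad-distinct : ∀ u v w → bad u v w ≢ 0 → u ≢ v × u ≢ w × v ≢ w
  bad-distinct u v w bad≢0 =
    let (uvw≢0 , _) = *≢0 (𝟙< u v * 𝟙≢ u w * 𝟙≢ v w) (𝟙 (edge u v) w) bad≢0
        (uv-uw≢0 , vw≢0) = *≢0 (𝟙< u v * 𝟙≢ u w) (𝟙≢ v w) uvw≢0
        (uv≢0 , uw≢0) = *≢0 (𝟙< u v) (𝟙≢ u w) uv-uw≢0
    in 𝟙<≢0⇒≢ u v uv≢0 , 𝟙≢≢0⇒≢ u w uw≢0 , 𝟙≢≢0⇒≢ v w vw≢0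

  open TripleCount bad bad-distinct public

  -- Each pair u < v lies in at most r bad triples, so there are at most r·N²/2.
  bad-total : ∀ {r} → RankAtMost r (edges H) → 2 * T ⊤ ≤ r * (N * N)
  bad-total {r} rank = begin
    2 * T ⊤                     ≤⟨ *-monoʳ-≤ 2 (sum-mono (λ u → sum-mono (per-pair u))) ⟩
    2 * sum (λ u → sum (λ v → r * lt u v))
      ≡⟨ cong (2 *_) (trans (sum-cong-≗ (λ u → sum-scale r (lt u))) (sum-scale r (λ u → sum (lt u)))) ⟩
    2 * (r * P)                 ≡⟨ x∙yz≈y∙xz 2 r P ⟩
    r * (2 * P)                 ≤⟨ *-monoʳ-≤ r (ordered-pairs N) ⟩
    r * (N * N)                 ∎
    where
    open ≤-Reasoning
    lt : Fin N → Fin N → ℕ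
    lt = 𝟙<
    P : ℕ
    P = sum (λ u → sum (lt u))
    per-pair : ∀ u v → sum (term ⊤ u v) ≤ r * 𝟙< u v
    per-pair u v = begin
      sum (term ⊤ u v)                           ≤⟨ sum-mono drop-factors ⟩
      sum (λ w → 𝟙< u v * 𝟙 (edge u v) w)        ≡⟨ sum-scale (𝟙< u v) (𝟙 (edge u v)) ⟩
      𝟙< u v * sum (𝟙 (edge u v))               ≡⟨ cong (𝟙< u v *_) (sum-𝟙 (edge u v)) ⟩
      𝟙< u v * ∣ edge u v ∣                      ≤⟨ *-monoʳ-≤ (𝟙< u v) (edge-size rank u v) ⟩
      𝟙< u v * r                                 ≡⟨ *-comm (𝟙< u v) r ⟩
      r * 𝟙< u v                                 ∎
      where
      drop-factors : ∀ w → term ⊤ u v w ≤ 𝟙< u v * 𝟙 (edge u v) w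
      drop-factors w rewrite 𝟙∈ (∈⊤ {x = u}) | 𝟙∈ (∈⊤ {x = v}) | 𝟙∈ (∈⊤ {x = w}) | +-identityʳ (bad u v w) =
        *-monoˡ-≤ (𝟙 (edge u v) w)
          (≤-trans (*-mono-≤ (*-monoʳ-≤ (𝟙< u v) (𝟙≢≤1 u w)) (𝟙≢≤1 v w))
                   (≤-reflexive (trans (*-identityʳ (𝟙< u v * 1)) (*-identityʳ (𝟙< u v)))))

  trace-small : ∀ X → T X ≡ 0 → ∀ {u v} → u ∈ X → v ∈ X → 𝟙< u v ≡ 1 → ∣ X ∩ edge u v ∣ ≤ 2
  trace-small X clear {u} {v} u∈X v∈X u<v = begin
    ∣ X ∩ e ∣                            ≡⟨ sum-𝟙 (X ∩ e) ⟨
    sum (𝟙 (X ∩ e))                      ≤⟨ sum-mono within ⟩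
    sum (λ w → 𝟙 ⁅ u ⁆ w + 𝟙 ⁅ v ⁆ w)    ≡⟨ ∑-distrib-+ (𝟙 ⁅ u ⁆) (𝟙 ⁅ v ⁆) ⟩
    sum (𝟙 ⁅ u ⁆) + sum (𝟙 ⁅ v ⁆)        ≡⟨ cong₂ _+_ (trans (sum-𝟙 ⁅ u ⁆) (∣⁅x⁆∣≡1 u)) (trans (sum-𝟙 ⁅ v ⁆) (∣⁅x⁆∣≡1 v)) ⟩
    2                                    ∎
    where
    open ≤-Reasoning
    e : Subset N
    e = edge u v
    reshape : ∀ a b → a * b ≡ 1 * 1 * a * (1 * 1 * 1 * b)
    reshape = solve-∀
    -- a vertex w ∉ {u, v} in X ∩ e would make (u, v, w) bad
    off-pair : ∀ w → w ≢ u → w ≢ v → 𝟙 (X ∩ e) w ≡ 0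
    off-pair w w≢u w≢v = begin-equality
      𝟙 (X ∩ e) w      ≡⟨ 𝟙-∩ X e w ⟩
      𝟙 X w * 𝟙 e w    ≡⟨ reshape (𝟙 X w) (𝟙 e w) ⟩
      1 * 1 * 𝟙 X w * (1 * 1 * 1 * 𝟙 e w)
        ≡⟨ cong₂ (λ a b → a * 𝟙 X w * b) (cong₂ _*_ (𝟙∈ u∈X) (𝟙∈ v∈X)) (cong (_* 𝟙 e w)
             (cong₂ _*_ (cong₂ _*_ u<v (𝟙≢-≢ (w≢u ∘ sym))) (𝟙≢-≢ (w≢v ∘ sym)))) ⟨
      term X u v w     ≡⟨ T≡0⇒term≡0 X clear u v w ⟩
      0                ∎
    within : ∀ w → 𝟙 (X ∩ e) w ≤ 𝟙 ⁅ u ⁆ w + 𝟙 ⁅ v ⁆ w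
    within w with w Fin.≟ u | w Fin.≟ v
    ... | yes refl | _ = ≤-trans (𝟙≤1 (X ∩ e) w) (≤-trans (≤-reflexive (sym (𝟙∈ (x∈⁅x⁆ w)))) (m≤m+n _ _))
    ... | no _ | yes refl = ≤-trans (𝟙≤1 (X ∩ e) w) (≤-trans (≤-reflexive (sym (𝟙∈ (x∈⁅x⁆ w)))) (m≤n+m _ _))
    ... | no w≢u | no w≢v = ≤-trans (≤-reflexive (off-pair w w≢u w≢v)) z≤n

  small-traces : Subset N → List (Subset N)
  small-traces X = filter (λ f → ∣ f ∣ ≤? 2) (map (X ∩_) (edges H))

  clear⇒full-rank2 : ∀ X → T X ≡ 0 → ∀ n → n ≤ ∣ X ∣ → HasFullRank2Sub H n
  clear⇒full-rank2 X clear n n≤∣X∣ = X , small-traces X , n≤∣X∣ , sub , full-on , all-filter (λ f → ∣ f ∣ ≤? 2) (map (X ∩_) (edges H))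
    where
    sub : SubEdges H X (small-traces X)
    sub = All.tabulate λ f∈ → let (e , e∈ , f≡X∩e) = ∈-map⁻ (X ∩_) (proj₁ (∈-filter⁻ (λ f → ∣ f ∣ ≤? 2) f∈)) in
      e , e∈ , f≡X∩e
    covered : ∀ {u v} → u ∈ X → v ∈ X → 𝟙< u v ≡ 1 → Any.Any (λ f → u ∈ f × v ∈ f) (small-traces X)
    covered {u} {v} u∈X v∈X u<v =
      let (e∈ , u∈e , v∈e) = edge-spec u v (𝟙<≢0⇒≢ u v (λ u<v≡0 → 0≢1+n (trans (sym u<v≡0) u<v)))
      in lose (∈-filter⁺ (λ f → ∣ f ∣ ≤? 2) (∈-map⁺ (X ∩_) e∈) (trace-small X clear u∈X v∈X u<v))
              (x∈p∩q⁺ (u∈X , u∈e) , x∈p∩q⁺ (v∈X , v∈e))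
    full-on : FullOn X (small-traces X)
    full-on u v u∈X v∈X u≢v with 𝟙<-total u≢v
    ... | inj₁ u<v = covered u∈X v∈X u<v
    ... | inj₂ v<u = Any.map swap (covered v∈X u∈X v<u)

  initial-density : ∀ {r} → RankAtMost r (edges H) → 2 * N * T ⊤ ≤ r * ∣ ⊤ {N} ∣ ^ 3
  initial-density {r} rank = begin
    2 * N * T ⊤           ≡⟨ xy∙z≈y∙xz 2 N (T ⊤) ⟩
    N * (2 * T ⊤)         ≤⟨ *-monoʳ-≤ N (bad-total rank) ⟩
    N * (r * (N * N))     ≡⟨ regroup N r ⟩
    r * N ^ 3             ≡⟨ cong (λ k → r * k ^ 3) (∣⊤∣≡n N) ⟨
    r * ∣ ⊤ {N} ∣ ^ 3     ∎
    where
    open ≤-Reasoning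
    regroup : ∀ N r → N * (r * (N * N)) ≡ r * (N * (N * (N * 1)))
    regroup = solve-∀

  -- Phase 1 shrinks the vertex set to
  -- M vertices keeping the density bound, phase 2 removes the remaining t bad
  -- triples at the cost of at most t further vertices.
  deletion-argument : ∀ {r} n M → RankAtMost r (edges H) → M ≤ N →
    (∀ t → 2 * N * t ≤ r * M ^ 3 → t + n ≤ M) → HasFullRank2Sub H n
  deletion-argument {r} n M rank M≤N budget
    with shrink (2 * N) r M (N ∸ M) ⊤ (trans (∣⊤∣≡n N) (sym (m∸n+n≡m M≤N))) (initial-density rank)
  ... | X₁ , size₁ , dense₁ with clean (T X₁) X₁ ≤-refl
  ... | X₂ , clear , kept = clear⇒full-rank2 X₂ clear n (+-cancelˡ-≤ (T X₁) n ∣ X₂ ∣ (begin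
    T X₁ + n        ≤⟨ budget (T X₁) dense₁ ⟩
    M               ≡⟨ size₁ ⟨
    ∣ X₁ ∣          ≤⟨ kept ⟩
    ∣ X₂ ∣ + T X₁   ≡⟨ +-comm ∣ X₂ ∣ (T X₁) ⟩
    T X₁ + ∣ X₂ ∣   ∎))
    where open ≤-Reasoning

halve : ∀ k → ∃[ M ] (2 * M ≤ k × k ≤ suc (2 * M))
halve zero = 0 , z≤n , z≤n
halve (suc zero) = 0 , z≤n , ≤-refl
halve (suc (suc k)) with halve k
... | M , lower , upper = suc M , subst (_≤ 2 + k) (sym (*-suc 2 M)) (s≤s (s≤s lower))
                               , subst (2 + k ≤_) (cong suc (sym (*-suc 2 M))) (s≤s (s≤s upper))

-- For m ≥ 1, M ≤ 3m/2 and 27r·m² ≤ 8N give M ≤ N, as 8M ≤ 12m ≤ 27r·m².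
budget-fits : ∀ r n N M → 1 ≤ r → 2 * M ≤ 3 * suc n → 27 * r * suc n ^ 2 ≤ 8 * N → M ≤ N
budget-fits r n N M 1≤r 2M≤3m dense = *-cancelˡ-≤ 8 (begin
  8 * M                        ≡⟨ *-assoc 4 2 M ⟩
  4 * (2 * M)                  ≤⟨ *-monoʳ-≤ 4 2M≤3m ⟩
  4 * (3 * m)                  ≡⟨ *-assoc 4 3 m ⟨
  12 * m                       ≤⟨ *-monoˡ-≤ m (m≤m+n 12 15) ⟩
  27 * m                       ≡⟨ *-identityʳ (27 * m) ⟨
  27 * m * 1                   ≤⟨ *-mono-≤ (*-monoˡ-≤ m (*-monoʳ-≤ 27 1≤r)) (s≤s z≤n) ⟩
  27 * r * m * m               ≡⟨ *-assoc (27 * r) m m ⟩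
  27 * r * (m * m)             ≡⟨ cong (λ k → 27 * r * (m * k)) (*-identityʳ m) ⟨
  27 * r * m ^ 2               ≤⟨ dense ⟩
  8 * N                        ∎)
  where
  open ≤-Reasoning
  m : ℕ
  m = suc n

-- For m = n + 1 and 3m ∈ {2M, 2M + 1}, a weight t with 2N·t ≤ r·M³ satisfies
-- t + n ≤ M: the hypothesis 27r·m² ≤ 8N turns 2N·t ≤ r·M³ into
-- 54t·m² ≤ (2M)³ ≤ (3m)³, i.e. 2t ≤ m, and then 2(t + n) + 2 ≤ 3m ≤ 2M + 1.
budget-suffices : ∀ r n N M t → 1 ≤ r → 2 * M ≤ 3 * suc n → 3 * suc n ≤ suc (2 * M) →
  27 * r * suc n ^ 2 ≤ 8 * N → 2 * N * t ≤ r * M ^ 3 → t + n ≤ M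
budget-suffices r n N M t 1≤r 2M≤3m 3m≤2M+1 dense sparse =
  *-cancelˡ-≤ 2 (+-cancelʳ-≤ 2 (2 * (t + n)) (2 * M) (begin
    2 * (t + n) + 2             ≡⟨ expand t n ⟩
    2 * t + 2 * m               ≤⟨ +-monoˡ-≤ (2 * m) 2t≤m ⟩
    m + 2 * m                   ≡⟨⟩
    3 * m                       ≤⟨ 3m≤2M+1 ⟩
    suc (2 * M)                 ≤⟨ n≤1+n _ ⟩
    2 + 2 * M                   ≡⟨ +-comm 2 (2 * M) ⟩
    2 * M + 2                   ∎))
  where
  open ≤-Reasoning
  m : ℕ
  m = suc n
  expand : ∀ t n → 2 * (t + n) + 2 ≡ 2 * t + 2 * (1 + n)
  expand = solve-∀
  weighted : 54 * t * m ^ 2 ≤ 8 * M ^ 3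
  weighted = *-cancelˡ-≤ r {{>-nonZero 1≤r}} (begin
    r * (54 * t * m ^ 2)           ≡⟨ lhs r t m ⟩
    2 * t * (27 * r * m ^ 2)       ≤⟨ *-monoʳ-≤ (2 * t) dense ⟩
    2 * t * (8 * N)                ≡⟨ mid t N ⟩
    8 * (2 * N * t)                ≤⟨ *-monoʳ-≤ 8 sparse ⟩
    8 * (r * M ^ 3)                ≡⟨ x∙yz≈y∙xz 8 r (M ^ 3) ⟩
    r * (8 * M ^ 3)                ∎)
    where
    lhs : ∀ r t m → r * (54 * t * (m * (m * 1))) ≡ 2 * t * (27 * r * (m * (m * 1)))
    lhs = solve-∀
    mid : ∀ t N → 2 * t * (8 * N) ≡ 8 * (2 * N * t)
    mid = solve-∀
  2t≤m : 2 * t ≤ m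
  2t≤m = *-cancelˡ-≤ (27 * m ^ 2) (begin
    27 * m ^ 2 * (2 * t)     ≡⟨ reorder t m ⟩
    54 * t * m ^ 2           ≤⟨ weighted ⟩
    8 * M ^ 3                ≡⟨ cube-double M ⟩
    (2 * M) ^ 3              ≤⟨ ^-monoˡ-≤ 3 2M≤3m ⟩
    (3 * m) ^ 3              ≡⟨ cube-triple m ⟩
    27 * m ^ 2 * m           ∎)
    where
    reorder : ∀ t m → 27 * (m * (m * 1)) * (2 * t) ≡ 54 * t * (m * (m * 1))
    reorder = solve-∀
    cube-double : ∀ M → 8 * (M * (M * (M * 1))) ≡ 2 * M * (2 * M * (2 * M * 1))
    cube-double = solve-∀
    cube-triple : ∀ m → 3 * m * (3 * m * (3 * m * 1)) ≡ 27 * (m * (m * 1)) * m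
    cube-triple = solve-∀

-- The number of vertices to keep: M = ⌊3(n + 1)/2⌋ fits into N and leaves room
-- for the weight of any set of M vertices obeying the density bound.
vertex-budget : ∀ r n N → 1 ≤ r → 27 * r * (n + 1) ^ 2 ≤ 8 * N →
  ∃[ M ] (M ≤ N × (∀ t → 2 * N * t ≤ r * M ^ 3 → t + n ≤ M))
vertex-budget r n N 1≤r dense with halve (3 * suc n)
... | M , 2M≤3m , 3m≤2M+1 =
  M , budget-fits r n N M 1≤r 2M≤3m dense′ , λ t → budget-suffices r n N M t 1≤r 2M≤3m 3m≤2M+1 dense′
  where
  dense′ : 27 * r * suc n ^ 2 ≤ 8 * N
  dense′ = subst (λ k → 27 * r * k ^ 2 ≤ 8 * N) (+-comm n 1) dense

corollary13 : (r n N : ℕ) → 2 ≤ r → 1 ≤ n → (H : Hypergraph N) →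
    Full H → RankAtMost r (edges H) →
    27 * r * (n + 1) ^ 2 ≤ 8 * N →
    HasFullRank2Sub H n
corollary13 r n N 2≤r _ H full rank dense =
  let (M , M≤N , budget) = vertex-budget r n N (≤-trans (s≤s z≤n) 2≤r) dense
  in ChosenEdges.deletion-argument H full n M rank M≤N budget
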